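{- Let $n \ge k \ge r \ge 2$ be integers and let $\mathcal{H}$ be a $k$-colorable $r$-graph on $n$ vertices without isolated vertices satisfying \[ \delta_{r-1}^{+}(\mathcal{H}) > \max\left\{\frac{3k-3r+1}{3k-2}\, n,\ \frac{k-r+1}{k+2}\, n\right\}. \] Then for every $\varphi\in\mathrm{Hom}(\mathcal{H},K_k^r)$ we have $|I_\varphi|\ge r$, where $I_\varphi = \{j\in[k] : |\varphi^{ -1}(j)| \ge \frac{n}{k+2}\}$.
   Context: An $r$-graph $\mathcal{H}$ is a collection of $r$-element subsets (edges) of a finite vertex set $V(\mathcal{H})$; a vertex is isolated if it lies in no edge. $\partial\mathcal{H}$ is the set of $(r-1)$-sets contained in some edge; for an $(r-1)$-set $S$, $d_{\mathcal{H}}(S)$ is the number of vertices $v$ with $S\cup\{v\}\in\mathcal{H}$, and $\delta^{+}_{r-1}(\mathcal{H})=\min\{d_{\mathcal{H}}(S): S\in\partial\mathcal{H}\}$. $\mathrm{Hom}(\mathcal{H},K_k^r)$ is the set of maps $\varphi:V(\mathcal{H})\to[k]$ that are injective on every edge; $\mathcal{H}$ is $k$-colorable if this set is nonempty. -}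

module Defs where

open import Data.Nat using (ℕ; _≤_; _<_; _*_; _∸_; _+_; _≤?_; _≟_)
open import Data.Bool using (Bool; true; false; not; _∧_)
open import Data.Fin using (Fin)
import Data.Fin.Properties as FinP
open import Data.Fin.Subset using (Subset; _∈_; _∉_; _⊆_; _∪_; ⁅_⁆; ∣_∣)
open import Data.Fin.Subset.Properties using (_∈?_)
open import Data.List using (List; length; filterᵇ; allFin)
open import Data.Product using (Σ; ∃; _×_)
open import Relation.Binary.PropositionalEquality using (_≡_)
open import Relation.Nullary using (does)

record RGraph (n r : ℕ) : Set where
  field
    edge    : Subset n → Bool
    uniform : ∀ e → edge e ≡ true → ∣ e ∣ ≡ r

open RGraph public

NoIsolated : ∀ {n r} → RGraph n r → Set
NoIsolated {n} H = ∀ (v : Fin n) → Σ (Subset n) λ e → edge H e ≡ true × v ∈ e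

InShadow : ∀ {n r} → RGraph n r → Subset n → Set
InShadow {n} {r} H S = ∣ S ∣ ≡ r ∸ 1 × Σ (Subset n) λ e → edge H e ≡ true × S ⊆ e

deg : ∀ {n r} → RGraph n r → Subset n → ℕ
deg {n} H S = length (filterᵇ (λ v → not (does (v ∈? S)) ∧ edge H (S ∪ ⁅ v ⁆)) (allFin n))

-- φ ∈ Hom(H, K_k^r): φ is injective on every edge
IsHom : ∀ {n r} → RGraph n r → (k : ℕ) → (Fin n → Fin k) → Set
IsHom {n} H k φ = ∀ e → edge H e ≡ true → ∀ (u v : Fin n) → u ∈ e → v ∈ e → φ u ≡ φ v → u ≡ v

Colorable : ∀ {n r} → RGraph n r → ℕ → Set
Colorable {n} H k = Σ (Fin n → Fin k) λ φ → IsHom H k φ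

preimageSize : ∀ {n k} → (Fin n → Fin k) → Fin k → ℕ
preimageSize {n} φ j = length (filterᵇ (λ v → does (φ v FinP.≟ j)) (allFin n))

-- |I_φ| where I_φ = { j ∈ [k] : |φ⁻¹(j)| ≥ n/(k+2) }, i.e. (k+2)·|φ⁻¹(j)| ≥ n
sizeIφ : ∀ {n k} → (Fin n → Fin k) → ℕ
sizeIφ {n} {k} φ = length (filterᵇ (λ j → does (n ≤? (k + 2) * preimageSize φ j)) (allFin k))

-- Suppose |I_φ| < r, and measure an edge e by the number of colours of I_φ that it misses.
-- Since φ is injective on e and |e| = r, some w ∈ e has a colour outside I_φ, and
-- S = e ∖ {w} lies in the shadow.  An extension v of S must avoid the r − 1 colours of S;
-- if no extension had a colour in I_φ, all of them would lie in the at most k − r + 1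
-- colour classes that are small (fewer than n/(k+2) vertices) and unused by S, giving
-- (k+2)·d(S) ≤ (k−r+1)·n against the degree condition.  So some extension v has a colour
-- of I_φ, one not used by e, and S ∪ {v} is an edge missing strictly fewer colours of I_φ
-- than e: an impossible infinite descent.
module Submission where

open import Defs
open import Data.Bool using (Bool; true; false; T; _∧_)
open import Data.Bool.Properties using (T-≡)
open import Data.Empty using (⊥-elim)
open import Data.Fin using (Fin; zero; suc; fromℕ<)
open import Data.Fin.Properties using (_≟_; any?)
import Data.Fin.Properties as Fin
open import Data.Fin.Subset using (Subset; _∈_; _∉_; _⊆_; _∪_; _-_; ⁅_⁆; ∣_∣; inside; outside)
open import Data.Fin.Subset.Properties using (_∈?_; x∈p∪q⁺; x∈⁅x⁆; p─⊥≡p; p─q⊆p; x∈p∧x≢y⇒x∈p-y)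
open import Data.List using (length; filterᵇ; tabulate)
open import Data.Nat using (ℕ; zero; suc; _+_; _*_; _∸_; _≤_; _<_; _≤?_; z≤n; s≤s)
open import Data.Nat.Induction using (<-wellFounded)
open import Data.Nat.Properties hiding (_≟_)
open import Data.Product using (∃; _×_; _,_; proj₁; proj₂)
open import Data.Sum using (inj₁; inj₂)
open import Data.Vec using (_∷_; []; here; there)
open import Function using (_∘_; id; _on_; Equivalence)
open import Induction.InfiniteDescent using (Descent; descent∧wf⇒empty)
open import Level using (Level; 0ℓ)
open import Relation.Binary.Construct.On as On using ()
open import Relation.Binary.PropositionalEquality
open import Relation.Nullary using (Dec; does; yes; no; ¬_; ¬?; _×-dec_)
open import Relation.Nullary.Decidable using (T?; decidable-stable)
open import Relation.Unary using (Pred; Decidable)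
open import Relation.Unary.Properties using (∁?; _∩?_)
open import Algebra.Properties.Semiring.Sum +-*-semiring
  using (sum; sum-syntax; sum-cong-≗; ∑-comm; sum-replicate-zero; *-distribˡ-sum; *-distribʳ-sum)

private
  variable
    a ℓ ℓ′ : Level
    A B : Set a
    m k : ℕ

𝟙 : Bool → ℕ
𝟙 true  = 1
𝟙 false = 0

count : {P : Pred (Fin m) ℓ} → Decidable P → ℕ
count {m} P? = ∑[ u < m ] 𝟙 (does (P? u))

𝟙-mono : (a? : Dec A) (b? : Dec B) → (A → B) → 𝟙 (does a?) ≤ 𝟙 (does b?)
𝟙-mono (no _)  _      _   = z≤n
𝟙-mono (yes _) (yes _) _   = ≤-refl
𝟙-mono (yes a) (no ¬b) a→b = ⊥-elim (¬b (a→b a))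

𝟙-< : (a? : Dec A) (b? : Dec B) → ¬ A → B → 𝟙 (does a?) < 𝟙 (does b?)
𝟙-< (yes a) _       ¬a _ = ⊥-elim (¬a a)
𝟙-< (no _)  (yes _) _  _ = ≤-refl
𝟙-< (no _)  (no ¬b) _  b = ⊥-elim (¬b b)

∑-mono-≤ : (f g : Fin m → ℕ) → (∀ i → f i ≤ g i) → sum f ≤ sum g
∑-mono-≤ {zero}  f g f≤g = z≤n
∑-mono-≤ {suc m} f g f≤g = +-mono-≤ (f≤g zero) (∑-mono-≤ (f ∘ suc) (g ∘ suc) (f≤g ∘ suc))

count-mono : ∀ {m} {P : Pred (Fin m) ℓ} {Q : Pred (Fin m) ℓ′} (P? : Decidable P) (Q? : Decidable Q) →
  (∀ {u} → P u → Q u) → count P? ≤ count Q?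
count-mono {m = zero}  P? Q? P⊆Q = z≤n
count-mono {m = suc m} P? Q? P⊆Q =
  +-mono-≤ (𝟙-mono (P? zero) (Q? zero) P⊆Q) (count-mono (P? ∘ suc) (Q? ∘ suc) P⊆Q)

count-strict-mono : ∀ {m} {P : Pred (Fin m) ℓ} {Q : Pred (Fin m) ℓ′} (P? : Decidable P) (Q? : Decidable Q) →
  (∀ {u} → P u → Q u) → ∀ w → ¬ P w → Q w → count P? < count Q?
count-strict-mono {m = suc m} P? Q? P⊆Q zero ¬Pw Qw =
  +-mono-<-≤ (𝟙-< (P? zero) (Q? zero) ¬Pw Qw) (count-mono (P? ∘ suc) (Q? ∘ suc) P⊆Q)
count-strict-mono {m = suc m} P? Q? P⊆Q (suc w) ¬Pw Qw =
  +-mono-≤-< (𝟙-mono (P? zero) (Q? zero) P⊆Q) (count-strict-mono (P? ∘ suc) (Q? ∘ suc) P⊆Q w ¬Pw Qw)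

count-empty : ∀ {m} {P : Pred (Fin m) ℓ} (P? : Decidable P) → (∀ u → ¬ P u) → count P? ≡ 0
count-empty {m = zero}  P? ∅ = refl
count-empty {m = suc m} P? ∅ with P? zero
... | yes P0 = ⊥-elim (∅ zero P0)
... | no _   = count-empty (P? ∘ suc) (∅ ∘ suc)

count-≤1 : ∀ {m} {P : Pred (Fin m) ℓ} (P? : Decidable P) → (∀ {u v} → P u → P v → u ≡ v) → count P? ≤ 1
count-≤1 {m = zero}  P? unique = z≤n
count-≤1 {m = suc m} P? unique with P? zero
... | yes P0 = ≤-reflexive (cong suc (count-empty (P? ∘ suc) λ u Pu → Fin.0≢1+n (unique P0 Pu)))
... | no _   = count-≤1 (P? ∘ suc) λ Pu Pv → Fin.suc-injective (unique Pu Pv)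

count+count-∁ : ∀ {m} {P : Pred (Fin m) ℓ} (P? : Decidable P) → count P? + count (∁? P?) ≡ m
count+count-∁ {m = zero}  P? = refl
count+count-∁ {m = suc m} P? with P? zero
... | yes _ = cong suc (count+count-∁ (P? ∘ suc))
... | no _  = trans (+-suc _ _) (cong suc (count+count-∁ (P? ∘ suc)))

count-∁ : ∀ {m} {P : Pred (Fin m) ℓ} (P? : Decidable P) → count (∁? P?) ≡ m ∸ count P?
count-∁ P? = trans (sym (m+n∸m≡n (count P?) _)) (cong (_∸ count P?) (count+count-∁ P?))

count-singleton : (i : Fin m) → count (i ≟_) ≡ 1
count-singleton {m = suc m} zero    = cong suc (sum-replicate-zero m)
count-singleton {m = suc m} (suc i) = count-singleton i

∑-𝟙-∧-≟ : ∀ (b : Bool) (i : Fin k) → ∑[ j < k ] 𝟙 (b ∧ does (i ≟ j)) ≡ 𝟙 b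
∑-𝟙-∧-≟ {k} false i = sum-replicate-zero k
∑-𝟙-∧-≟     true  i = count-singleton i

count-fibres : ∀ {m} {P : Pred (Fin m) ℓ} (P? : Decidable P) (f : Fin m → Fin k) →
  count P? ≡ ∑[ j < k ] count (P? ∩? λ u → f u ≟ j)
count-fibres {k = k} {m = m} P? f = begin
  ∑[ u < m ] 𝟙 (does (P? u))
    ≡⟨ sum-cong-≗ (λ u → sym (∑-𝟙-∧-≟ (does (P? u)) (f u))) ⟩
  ∑[ u < m ] ∑[ j < k ] 𝟙 (does (P? u) ∧ does (f u ≟ j))
    ≡⟨ ∑-comm (λ u j → 𝟙 (does (P? u) ∧ does (f u ≟ j))) ⟩
  ∑[ j < k ] ∑[ u < m ] 𝟙 (does (P? u) ∧ does (f u ≟ j)) ∎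
  where open ≡-Reasoning

count-≤-fibres : ∀ {m} {P : Pred (Fin m) ℓ} {Q : Pred (Fin k) ℓ′}
  (P? : Decidable P) (Q? : Decidable Q) (f : Fin m → Fin k) (c b : ℕ) →
  (∀ {u} → P u → Q (f u)) →
  (∀ {j} → Q j → c * count (P? ∩? λ u → f u ≟ j) ≤ b) →
  c * count P? ≤ count Q? * b
count-≤-fibres {k = k} P? Q? f c b P⇒Q∘f fibre≤ = begin
  c * count P?                                   ≡⟨ cong (c *_) (count-fibres P? f) ⟩
  c * ∑[ j < k ] count (fibre j)                 ≡⟨ *-distribˡ-sum c (count ∘ fibre) ⟩
  ∑[ j < k ] (c * count (fibre j))               ≤⟨ ∑-mono-≤ _ _ term ⟩
  ∑[ j < k ] (𝟙 (does (Q? j)) * b)               ≡⟨ *-distribʳ-sum b (𝟙 ∘ does ∘ Q?) ⟨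
  count Q? * b                                   ∎
  where
  open ≤-Reasoning
  fibre : (j : Fin k) → Decidable _
  fibre j = P? ∩? λ u → f u ≟ j
  term : ∀ j → c * count (fibre j) ≤ 𝟙 (does (Q? j)) * b
  term j with Q? j
  ... | yes Qj = subst (c * count (fibre j) ≤_) (sym (*-identityˡ b)) (fibre≤ Qj)
  ... | no ¬Qj = ≤-reflexive (trans (cong (c *_) (count-empty (fibre j) λ { u (Pu , refl) → ¬Qj (P⇒Q∘f Pu) }))
                                   (*-zeroʳ c))

count-≤-injection : ∀ {m} {P : Pred (Fin m) ℓ} {Q : Pred (Fin k) ℓ′}
  (P? : Decidable P) (Q? : Decidable Q) (f : Fin m → Fin k) →
  (∀ {u v} → P u → P v → f u ≡ f v → u ≡ v) → (∀ {u} → P u → Q (f u)) →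
  count P? ≤ count Q?
count-≤-injection P? Q? f injective P⇒Q∘f =
  subst₂ _≤_ (*-identityˡ (count P?)) (*-identityʳ (count Q?))
    (count-≤-fibres P? Q? f 1 1 P⇒Q∘f λ {j} _ →
      subst (_≤ 1) (sym (*-identityˡ _))
        (count-≤1 (P? ∩? λ u → f u ≟ j) λ (Pu , fu≡j) (Pv , fv≡j) →
          injective Pu Pv (trans fu≡j (sym fv≡j))))

length-filterᵇ-tabulate : (p : A → Bool) (g : Fin m → A) →
  length (filterᵇ p (tabulate g)) ≡ ∑[ u < m ] 𝟙 (p (g u))
length-filterᵇ-tabulate {m = zero}  p g = refl
length-filterᵇ-tabulate {m = suc m} p g with p (g zero)
... | true  = cong suc (length-filterᵇ-tabulate p (g ∘ suc))
... | false = length-filterᵇ-tabulate p (g ∘ suc)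

∣p∣≡count-∈ : (p : Subset m) → ∣ p ∣ ≡ count (_∈? p)
∣p∣≡count-∈ []            = refl
∣p∣≡count-∈ (inside  ∷ p) = cong suc (∣p∣≡count-∈ p)
∣p∣≡count-∈ (outside ∷ p) = ∣p∣≡count-∈ p

x∈p⇒∣p-x∣+1≡∣p∣ : ∀ {x} {p : Subset m} → x ∈ p → suc ∣ p - x ∣ ≡ ∣ p ∣
x∈p⇒∣p-x∣+1≡∣p∣ {p = inside  ∷ p} here        = cong (suc ∘ ∣_∣) (p─⊥≡p p)
x∈p⇒∣p-x∣+1≡∣p∣ {p = inside  ∷ p} (there x∈p) = cong suc (x∈p⇒∣p-x∣+1≡∣p∣ x∈p)
x∈p⇒∣p-x∣+1≡∣p∣ {p = outside ∷ p} (there x∈p) = x∈p⇒∣p-x∣+1≡∣p∣ x∈p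

k∸[r∸1]≡k∸r+1 : ∀ {k r} → 1 ≤ r → r ≤ k → k ∸ (r ∸ 1) ≡ k ∸ r + 1
k∸[r∸1]≡k∸r+1 {suc k} {suc r} (s≤s z≤n) (s≤s r≤k) = trans (+-∸-assoc 1 r≤k) (+-comm 1 (k ∸ r))

module _ {n k r : ℕ} (H : RGraph n r) where

  Extension : Subset n → Pred (Fin n) 0ℓ
  Extension S v = v ∉ S × T (edge H (S ∪ ⁅ v ⁆))

  Extension? : (S : Subset n) → Decidable (Extension S)
  Extension? S v = ¬? (v ∈? S) ×-dec T? (edge H (S ∪ ⁅ v ⁆))

  deg≡count : ∀ S → deg H S ≡ count (Extension? S)
  deg≡count S = length-filterᵇ-tabulate (does ∘ Extension? S) id

  e-w∈shadow : ∀ {e w} → edge H e ≡ true → w ∈ e → InShadow H (e - w)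
  e-w∈shadow {e} {w} e∈H w∈e =
    cong (_∸ 1) (trans (x∈p⇒∣p-x∣+1≡∣p∣ w∈e) (uniform H e e∈H)) , e , e∈H , p─q⊆p e ⁅ w ⁆

  module _ (φ : Fin n → Fin k) where

    Iφ : Pred (Fin k) 0ℓ
    Iφ j = n ≤ (k + 2) * preimageSize φ j

    Iφ? : Decidable Iφ
    Iφ? j = n ≤? (k + 2) * preimageSize φ j

    sizeIφ≡count : sizeIφ φ ≡ count Iφ?
    sizeIφ≡count = length-filterᵇ-tabulate (does ∘ Iφ?) id

    preimageSize≡count : ∀ j → preimageSize φ j ≡ count (λ u → φ u ≟ j)
    preimageSize≡count j = length-filterᵇ-tabulate (λ u → does (φ u ≟ j)) id

    Colours : Subset n → Pred (Fin k) 0ℓ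
    Colours X j = ∃ λ u → u ∈ X × φ u ≡ j

    Colours? : (X : Subset n) → Decidable (Colours X)
    Colours? X j = any? λ u → u ∈? X ×-dec φ u ≟ j

    module _ (hom : IsHom H k φ) where

      ⊆edge⇒∣X∣≤count : ∀ {e X} {Q : Pred (Fin k) ℓ} (Q? : Decidable Q) →
        edge H e ≡ true → X ⊆ e → (∀ {u} → u ∈ X → Q (φ u)) → ∣ X ∣ ≤ count Q?
      ⊆edge⇒∣X∣≤count {e = e} {X = X} Q? e∈H X⊆e X⇒Q∘φ =
        subst (_≤ count Q?) (sym (∣p∣≡count-∈ X))
          (count-≤-injection (_∈? X) Q? φ (λ u∈X v∈X → hom e e∈H _ _ (X⊆e u∈X) (X⊆e v∈X)) X⇒Q∘φ)

      ∃-vertex∉Iφ : count Iφ? < r → ∀ {e} → edge H e ≡ true → ∃ λ w → w ∈ e × ¬ Iφ (φ w)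
      ∃-vertex∉Iφ ∣Iφ∣<r {e} e∈H with any? (λ w → w ∈? e ×-dec ¬? (Iφ? (φ w)))
      ... | yes found = found
      ... | no none   = ⊥-elim (<⇒≱ ∣Iφ∣<r (subst (_≤ count Iφ?) (uniform H e e∈H)
              (⊆edge⇒∣X∣≤count Iφ? e∈H (λ u∈e → u∈e) λ {u} u∈e →
                decidable-stable (Iφ? (φ u)) λ u∉Iφ → none (u , u∈e , u∉Iφ))))

      Extension⇒new-colour : ∀ {S v} → Extension S v → ¬ Colours S (φ v)
      Extension⇒new-colour {S} {v} (v∉S , e′∈H) (u , u∈S , φu≡φv) = v∉S (subst (_∈ S) u≡v u∈S)
        where
        u≡v : u ≡ v
        u≡v = hom (S ∪ ⁅ v ⁆) (Equivalence.to T-≡ e′∈H) u v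
                (x∈p∪q⁺ (inj₁ u∈S)) (x∈p∪q⁺ (inj₂ (x∈⁅x⁆ v))) φu≡φv

      count-unused-colours : ∀ {S} → InShadow H S → count (∁? (Colours? S)) ≤ k ∸ (r ∸ 1)
      count-unused-colours {S} (∣S∣≡r∸1 , e , e∈H , S⊆e) = begin
        count (∁? (Colours? S)) ≡⟨ count-∁ (Colours? S) ⟩
        k ∸ count (Colours? S)  ≤⟨ ∸-monoʳ-≤ k (⊆edge⇒∣X∣≤count (Colours? S) e∈H S⊆e (λ u∈S → _ , u∈S , refl)) ⟩
        k ∸ ∣ S ∣               ≡⟨ cong (k ∸_) ∣S∣≡r∸1 ⟩
        k ∸ (r ∸ 1)             ∎
        where open ≤-Reasoning

      degree-bound : 1 ≤ r → r ≤ k → ∀ {S} → InShadow H S → (∀ {v} → Extension S v → ¬ Iφ (φ v)) →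
        (k + 2) * deg H S ≤ (k ∸ r + 1) * n
      degree-bound 1≤r r≤k {S} shadow ext⇒∉Iφ = begin
        (k + 2) * deg H S              ≡⟨ cong ((k + 2) *_) (deg≡count S) ⟩
        (k + 2) * count (Extension? S) ≤⟨ count-≤-fibres (Extension? S) Small? φ (k + 2) n
                                             ext⇒Small small-fibre ⟩
        count Small? * n               ≤⟨ *-monoˡ-≤ n count-Small ⟩
        (k ∸ r + 1) * n                ∎
        where
        open ≤-Reasoning
        Small? : Decidable _
        Small? = ∁? Iφ? ∩? ∁? (Colours? S)
        ext⇒Small : ∀ {v} → Extension S v → ¬ Iφ (φ v) × ¬ Colours S (φ v)
        ext⇒Small ext = ext⇒∉Iφ ext , Extension⇒new-colour ext
        small-fibre : ∀ {j} → ¬ Iφ j × ¬ Colours S j → (k + 2) * count (Extension? S ∩? λ v → φ v ≟ j) ≤ n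
        small-fibre {j} (j∉Iφ , _) =
          ≤-trans (*-monoʳ-≤ (k + 2) (count-mono (Extension? S ∩? fibre) fibre proj₂))
          (<⇒≤ (subst (λ x → (k + 2) * x < n) (preimageSize≡count j) (≰⇒> j∉Iφ)))
          where
          fibre : Decidable (λ v → φ v ≡ j)
          fibre v = φ v ≟ j
        count-Small : count Small? ≤ k ∸ r + 1
        count-Small = begin
          count Small?                 ≤⟨ count-mono Small? (∁? (Colours? S)) proj₂ ⟩
          count (∁? (Colours? S))     ≤⟨ count-unused-colours shadow ⟩
          k ∸ (r ∸ 1)                  ≡⟨ k∸[r∸1]≡k∸r+1 1≤r r≤k ⟩
          k ∸ r + 1                    ∎

      missed : Subset n → ℕ
      missed e = count (Iφ? ∩? ∁? (Colours? e))

      missed-decreases : ∀ {e w v} → w ∈ e → ¬ Iφ (φ w) → Extension (e - w) v → Iφ (φ v) →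
        missed ((e - w) ∪ ⁅ v ⁆) < missed e
      missed-decreases {e} {w} {v} w∈e w∉Iφ ext v∈Iφ =
        count-strict-mono (Iφ? ∩? ∁? (Colours? e′)) (Iφ? ∩? ∁? (Colours? e)) still-missed (φ v)
          (λ (_ , ¬new) → ¬new (v , x∈p∪q⁺ (inj₂ (x∈⁅x⁆ v)) , refl)) (v∈Iφ , ¬old)
        where
        e′ : Subset n
        e′ = (e - w) ∪ ⁅ v ⁆
        large⇒∈e-w : ∀ {u} → u ∈ e → Iφ (φ u) → u ∈ e - w
        large⇒∈e-w u∈e u∈Iφ = x∈p∧x≢y⇒x∈p-y u∈e λ { refl → w∉Iφ u∈Iφ }
        still-missed : ∀ {j} → Iφ j × ¬ Colours e′ j → Iφ j × ¬ Colours e j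
        still-missed (j∈Iφ , ¬new) =
          j∈Iφ , λ { (u , u∈e , refl) → ¬new (u , x∈p∪q⁺ (inj₁ (large⇒∈e-w u∈e j∈Iφ)) , refl) }
        ¬old : ¬ Colours e (φ v)
        ¬old (u , u∈e , φu≡φv) =
          Extension⇒new-colour ext (u , large⇒∈e-w u∈e (subst Iφ (sym φu≡φv) v∈Iφ) , φu≡φv)

      module _ (1≤r : 1 ≤ r) (r≤k : r ≤ k)
        (dense : ∀ S → InShadow H S → (k ∸ r + 1) * n < (k + 2) * deg H S) where

        large-extension : ∀ {S} → InShadow H S → ∃ λ v → Extension S v × Iφ (φ v)
        large-extension {S} shadow with any? (λ v → Extension? S v ×-dec Iφ? (φ v))
        ... | yes found = found
        ... | no none   = ⊥-elim (<⇒≱ (dense S shadow)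
                (degree-bound 1≤r r≤k shadow λ ext v∈Iφ → none (_ , ext , v∈Iφ)))

        missed-descent : count Iφ? < r → Descent (_<_ on missed) (λ e → edge H e ≡ true)
        missed-descent ∣Iφ∣<r {e} e∈H =
          let w , w∈e , w∉Iφ = ∃-vertex∉Iφ ∣Iφ∣<r e∈H
              v , ext , v∈Iφ = large-extension (e-w∈shadow e∈H w∈e)
          in (e - w) ∪ ⁅ v ⁆ , missed-decreases w∈e w∉Iφ ext v∈Iφ , Equivalence.to T-≡ (proj₂ ext)

        r≤count-Iφ : ∀ {e} → edge H e ≡ true → r ≤ count Iφ?
        r≤count-Iφ {e} e∈H = decidable-stable (r ≤? count Iφ?) λ r≰∣Iφ∣ →
          descent∧wf⇒empty (missed-descent (≰⇒> r≰∣Iφ∣)) (On.wellFounded missed <-wellFounded) e e∈H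

proposition2p3 : (n k r : ℕ) → 2 ≤ r → r ≤ k → k ≤ n →
    (H : RGraph n r) → Colorable H k → NoIsolated H →
    (∀ (S : Subset n) → InShadow H S →
        ((3 * k ∸ 3 * r + 1) * n < (3 * k ∸ 2) * deg H S)
        × ((k ∸ r + 1) * n < (k + 2) * deg H S)) →
    (φ : Fin n → Fin k) → IsHom H k φ → r ≤ sizeIφ φ
proposition2p3 n k r 2≤r r≤k k≤n H _ noIsolated dense φ hom =
  subst (r ≤_) (sym (sizeIφ≡count H φ))
    (r≤count-Iφ H φ hom 1≤r r≤k (λ S → proj₂ ∘ dense S) (proj₁ (proj₂ (noIsolated vertex))))
  where
  1≤r : 1 ≤ r
  1≤r = ≤-trans (s≤s z≤n) 2≤r
  vertex : Fin n
  vertex = fromℕ< (≤-trans 1≤r (≤-trans r≤k k≤n))
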